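{- Let $p$ be a prime, $q=p^h$, $n\ge2$, $e\geq2$ an integer and $N=(n+1)e-1$. Let $c\in\mathcal{C}_{2e-1}(N,q)^\perp$ and define $c':\{\text{points of }\textnormal{PG}(n,q^e)\}\to\mathbb F_p$ by $c'(P)=c\cdot\mathcal B(P)=\sum_{Q\in\mathcal B(P)}c(Q)$. Then $c'\in\mathcal{C}_1(n,q^e)^\perp$ and $\textnormal{wt}(c')\leq\textnormal{wt}(c)$.
   Context: $\textnormal{PG}(m,r)$ is the Desarguesian projective space of dimension $m$ over $\mathbb F_r$. For a prime power $r$ of $p$, $V(0,m,r)$ is the $\mathbb F_p$-space of functions from the points of $\textnormal{PG}(m,r)$ to $\mathbb F_p$ with scalar product $v\cdot w=\sum_P v(P)w(P)$; a subspace is identified with its characteristic function; $\mathcal{C}_k(m,r)$ is the $\mathbb F_p$-span of all $k$-spaces of $\textnormal{PG}(m,r)$ and $^\perp$ its orthogonal complement; weight = number of points with nonzero value. Field reduction: $\textnormal{PG}(n,q^e)$ is the projective space of $\mathbb F_{q^e}^{n+1}$; viewing $\mathbb F_{q^e}^{n+1}$ as an $(n+1)e$-dimensional $\mathbb F_q$-vector space gives $\textnormal{PG}(N,q)$, and each $k$-space $\kappa$ of $\textnormal{PG}(n,q^e)$ (an $\mathbb F_{q^e}$-subspace of dimension $k+1$) corresponds to the $((k+1)e-1)$-space $\mathcal B(\kappa)$ of $\textnormal{PG}(N,q)$ formed by the same vector subspace. In particular the sets $\mathcal B(P)$, $P$ a point, form an $(e-1)$-spread of $\textnormal{PG}(N,q)$.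 -}

module Defs where

open import Level using (0ℓ)
open import Data.Nat using (ℕ; zero; suc; NonZero)
import Data.Nat as N
open import Data.Nat.Primality using (Prime)
open import Data.Nat.DivMod using (_mod_)
open import Data.Fin using (Fin; toℕ)
open import Data.Bool using (Bool; true; false; if_then_else_; _∧_; not)
open import Data.List using (List; []; _∷_; map; concatMap; filter; filterᵇ; length; foldr)
open import Data.Bool.ListAction using (any)
open import Data.List.Membership.Propositional using (_∈_)
open import Data.List.Relation.Unary.Unique.Propositional using (Unique)
open import Data.Vec using (Vec; []; _∷_; take; drop; zipWith)
import Data.Vec as V
open import Data.Vec.Properties using (≡-dec)
open import Data.Product using (Σ; _×_; _,_; ∃; proj₁; proj₂)
open import Relation.Binary.PropositionalEquality using (_≡_; _≢_)
open import Relation.Binary.Definitions using (DecidableEquality)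
open import Relation.Nullary using (¬_; Dec; yes; no; does)
open import Algebra.Structures using (IsCommutativeRing)

record FiniteField : Set₁ where
  field
    Carrier  : Set
    _≟_      : DecidableEquality Carrier
    _+_ _*_  : Carrier → Carrier → Carrier
    -_       : Carrier → Carrier
    0# 1#    : Carrier
    isCommutativeRing : IsCommutativeRing _≡_ _+_ _*_ -_ 0# 1#
    0≢1      : 0# ≢ 1#
    inverse  : ∀ x → x ≢ 0# → Σ Carrier λ y → x * y ≡ 1#
    elements : List Carrier
    complete : ∀ x → x ∈ elements
    unique   : Unique elements

  order : ℕ
  order = length elements

  allVecs : (d : ℕ) → List (Vec Carrier d)
  allVecs zero    = [] ∷ []
  allVecs (suc d) = concatMap (λ x → map (x ∷_) (allVecs d)) elements

  isZero : Carrier → Bool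
  isZero x = does (x ≟ 0#)

  isOne : Carrier → Bool
  isOne x = does (x ≟ 1#)

  -- canonical representative of a projective point:
  -- nonzero vector whose first nonzero coordinate equals 1
  normalized : ∀ {d} → Vec Carrier d → Bool
  normalized []       = false
  normalized (x ∷ v)  = if isOne x then true else (isZero x ∧ normalized v)

  -- the points of the projective space of Carrier^d  (= PG(d-1, |F|))
  points : (d : ℕ) → List (Vec Carrier d)
  points d = filterᵇ normalized (allVecs d)

  vecEq : ∀ {d} → Vec Carrier d → Vec Carrier d → Bool
  vecEq u v = does (≡-dec _≟_ u v)

  zeroVec : ∀ d → Vec Carrier d
  zeroVec d = V.replicate d 0#

  lincomb : ∀ {t d} → Vec Carrier t → Vec (Vec Carrier d) t → Vec Carrier d
  lincomb {d = d} [] []       = zeroVec d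
  lincomb (a ∷ as) (g ∷ gs) = zipWith _+_ (V.map (a *_) g) (lincomb as gs)

  scale : ∀ {d} → Carrier → Vec Carrier d → Vec Carrier d
  scale a v = V.map (a *_) v

  -- a (t-1)-dimensional projective subspace of PG(d-1, |F|), i.e. a
  -- t-dimensional vector subspace of Carrier^d, given by a basis
  record Subspace (d t : ℕ) : Set where
    field
      gens        : Vec (Vec Carrier d) t
      independent : ∀ (a : Vec Carrier t) → lincomb a gens ≡ zeroVec d → a ≡ zeroVec t

  inSubspace : ∀ {d t} → Subspace d t → Vec Carrier d → Bool
  inSubspace {d} {t} κ P = any (λ a → vecEq (lincomb a (Subspace.gens κ)) P) (allVecs t)

-- The space V(0,m,r) of F_p-valued functions on the points of PG(m,r),
-- with PG(m,r) realised as the points of F^d, d = m+1.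
-- Functions are arbitrary maps Vec F d → Fin p; only their values on
-- (normalized representatives of) points matter.

prime⇒nonZero : ∀ {p} → Prime p → NonZero p
prime⇒nonZero {suc _} _ = _
prime⇒nonZero {zero} (Data.Nat.Primality.prime {{()}} _)

module Codes (F : FiniteField) (p : ℕ) (pr : Prime p) where
  open FiniteField F

  instance
    p≢0 : NonZero p
    p≢0 = prime⇒nonZero pr

  Fn : ℕ → Set
  Fn d = Vec Carrier d → Fin p

  sumℕ : List ℕ → ℕ
  sumℕ = foldr N._+_ 0

  dot : ∀ {d} → Fn d → Fn d → Fin p
  dot {d} v w = sumℕ (map (λ P → toℕ (v P) N.* toℕ (w P)) (points d)) mod p

  χ : ∀ {d t} → Subspace d t → Fn d
  χ κ P = (if inSubspace κ P then 1 else 0) mod p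

  -- C_k(m,r) with d = m+1, t = k+1 : the F_p-span of the characteristic
  -- functions of all k-spaces (equality of functions on the points)
  InCode : (d t : ℕ) → Fn d → Set
  InCode d t w =
    Σ (List (Fin p × Subspace d t)) λ l →
      ∀ P → normalized P ≡ true →
        w P ≡ sumℕ (map (λ aκ → toℕ (proj₁ aκ) N.* toℕ (χ (proj₂ aκ) P)) l) mod p

  InDual : (d t : ℕ) → Fn d → Set
  InDual d t c = ∀ w → InCode d t w → dot c w ≡ 0 mod p

  wt : ∀ {d} → Fn d → ℕ
  wt {d} c = length (filterᵇ (λ P → not (does (toℕ (c P) N.≟ 0))) (points d))

-- Field reduction data: F a subfield of K (via a ring embedding ι) and an
-- F-basis ω of K of size e.

record FieldReduction (F K : FiniteField) (e : ℕ) : Set where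
  private
    module F = FiniteField F
    module K = FiniteField K
  field
    ι       : F.Carrier → K.Carrier
    ι-+     : ∀ x y → ι (x F.+ y) ≡ ι x K.+ ι y
    ι-*     : ∀ x y → ι (x F.* y) ≡ ι x K.* ι y
    ι-1     : ι F.1# ≡ K.1#
    ω       : Vec K.Carrier e

  coord : Vec F.Carrier e → K.Carrier
  coord a = V.foldr _ K._+_ K.0# (zipWith (λ x w → ι x K.* w) a ω)

  field
    coord-injective  : ∀ a b → coord a ≡ coord b → a ≡ b
    coord-surjective : ∀ x → Σ (Vec F.Carrier e) λ a → coord a ≡ x

  φ : ∀ m → Vec F.Carrier (m N.* e) → Vec K.Carrier m
  φ zero    _  = []
  φ (suc m) xs = coord (take e xs) ∷ φ m (drop e xs)

  -- Q (a point of PG(N,q)) lies in B(P) (P a point of PG(n,q^e)):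
  -- the vector φ(Q) lies in the K-span of P
  inB : ∀ m → Vec K.Carrier m → Vec F.Carrier (m N.* e) → Bool
  inB m P Q = any (λ λ' → K.vecEq (φ m Q) (K.scale λ' P)) K.elements

  reduce : (p : ℕ) (pr : Prime p) → ∀ m →
           Codes.Fn F p pr (m N.* e) → Codes.Fn K p pr m
  reduce p pr m c P =
    Codes.sumℕ F p pr (map (λ Q → toℕ (c Q)) (filterᵇ (inB m P) (F.points (m N.* e))))
      Data.Nat.DivMod.mod p
    where open Codes F p pr using (p≢0)

module Submission where

-- Let φ : F^((n+1)e) → K^(n+1) be the F-linear isomorphism given by the basis ω, so that
-- B(P) consists of the points Q with φ(Q) ∈ ⟨P⟩. Every point Q lies in exactly one B(P),
-- namely for P the normalised representative π(Q) of φ(Q). Hence for every w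
--   c′ · w = Σ_P Σ_{Q ∈ B(P)} c(Q) w(P) = Σ_Q c(Q) w(π(Q)) = c · (w ∘ π).
-- If w is a combination of lines κ of PG(n,q^e), then w ∘ π is the same combination of the
-- (2e-1)-spaces B(κ), so c′ · w = 0. For the weight: c′(P) ≠ 0 forces c to be nonzero on
-- B(P), and the B(P) are pairwise disjoint.

open import Data.Nat using (ℕ)
open import Data.Nat.Primality using (Prime)
open import Defs

module Counting where

  open import Data.Bool using (Bool; true; false; not)
  open import Data.Empty using (⊥-elim)
  open import Data.Fin.Properties using (fromℕ<-cong)
  open import Data.List using (List; []; _∷_; map; concatMap; filterᵇ; length; _++_)
  open import Data.List.Membership.Propositional using (_∈_)
  import Data.List.Relation.Unary.All as All
  open import Data.List.Relation.Unary.All.Properties using (All¬⇒¬Any)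
  open import Data.List.Relation.Unary.AllPairs using (_∷_)
  open import Data.List.Relation.Unary.Any using (here; there)
  open import Data.List.Relation.Unary.Unique.Propositional using (Unique)
  open import Data.Nat using (zero; suc; _+_; _*_; _≤_; _%_; z≤n; s≤s; NonZero)
  open import Data.Nat.DivMod using (_mod_; m%n<n; %-distribˡ-*; %-distribˡ-+; m%n%n≡m%n)
  open import Data.Nat.ListAction using (sum)
  open import Data.Nat.Properties
  open import Data.Nat.Tactic.RingSolver using (solve-∀)
  open import Relation.Binary.Definitions using (DecidableEquality)
  open import Relation.Binary.PropositionalEquality
  open import Relation.Nullary using (yes; no; does)

  ⟦_⟧ : Bool → ℕ
  ⟦ true ⟧  = 1
  ⟦ false ⟧ = 0

  signum : ℕ → ℕ
  signum zero    = 0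
  signum (suc _) = 1

  ∑ : ∀ {A : Set} → List A → (A → ℕ) → ℕ
  ∑ xs f = sum (map f xs)

  module _ {A : Set} where

    ∑-cong-∈ : ∀ (xs : List A) {f g : A → ℕ} → (∀ x → x ∈ xs → f x ≡ g x) → ∑ xs f ≡ ∑ xs g
    ∑-cong-∈ []       eq = refl
    ∑-cong-∈ (x ∷ xs) eq = cong₂ _+_ (eq x (here refl)) (∑-cong-∈ xs (λ y y∈ → eq y (there y∈)))

    ∑-cong : ∀ (xs : List A) {f g : A → ℕ} → (∀ x → f x ≡ g x) → ∑ xs f ≡ ∑ xs g
    ∑-cong xs eq = ∑-cong-∈ xs (λ x _ → eq x)

    ∑-mono : ∀ (xs : List A) {f g : A → ℕ} → (∀ x → f x ≤ g x) → ∑ xs f ≤ ∑ xs g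
    ∑-mono []       le = z≤n
    ∑-mono (x ∷ xs) le = +-mono-≤ (le x) (∑-mono xs le)

    ∑-zero : ∀ (xs : List A) → ∑ xs (λ _ → 0) ≡ 0
    ∑-zero []       = refl
    ∑-zero (_ ∷ xs) = ∑-zero xs

    ∑-+ : ∀ (xs : List A) (f g : A → ℕ) → ∑ xs (λ x → f x + g x) ≡ ∑ xs f + ∑ xs g
    ∑-+ []       f g = refl
    ∑-+ (x ∷ xs) f g = begin
      f x + g x + ∑ xs (λ y → f y + g y) ≡⟨ cong (f x + g x +_) (∑-+ xs f g) ⟩
      f x + g x + (∑ xs f + ∑ xs g)      ≡⟨ +-interchange (f x) (g x) _ _ ⟩
      f x + ∑ xs f + (g x + ∑ xs g)      ∎
      where
      open ≡-Reasoning
      +-interchange : ∀ a b c d → a + b + (c + d) ≡ a + c + (b + d)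
      +-interchange = solve-∀

    ∑-*ˡ : ∀ (xs : List A) k (f : A → ℕ) → ∑ xs (λ x → k * f x) ≡ k * ∑ xs f
    ∑-*ˡ []       k f = sym (*-zeroʳ k)
    ∑-*ˡ (x ∷ xs) k f = trans (cong (k * f x +_) (∑-*ˡ xs k f)) (sym (*-distribˡ-+ k (f x) _))

    ∑-*ʳ : ∀ (xs : List A) k (f : A → ℕ) → ∑ xs (λ x → f x * k) ≡ ∑ xs f * k
    ∑-*ʳ xs k f = trans (∑-cong xs (λ x → *-comm (f x) k)) (trans (∑-*ˡ xs k f) (*-comm k _))

    ∑-++ : ∀ (xs ys : List A) f → ∑ (xs ++ ys) f ≡ ∑ xs f + ∑ ys f
    ∑-++ []       ys f = refl
    ∑-++ (x ∷ xs) ys f = trans (cong (f x +_) (∑-++ xs ys f)) (sym (+-assoc (f x) _ _))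

    ∑-filterᵇ : ∀ (b : A → Bool) (xs : List A) (f : A → ℕ) →
      ∑ (filterᵇ b xs) f ≡ ∑ xs (λ x → ⟦ b x ⟧ * f x)
    ∑-filterᵇ b []       f = refl
    ∑-filterᵇ b (x ∷ xs) f with b x
    ... | true  = cong₂ _+_ (sym (+-identityʳ (f x))) (∑-filterᵇ b xs f)
    ... | false = ∑-filterᵇ b xs f

    length-filterᵇ : ∀ (b : A → Bool) (xs : List A) → length (filterᵇ b xs) ≡ ∑ xs (λ x → ⟦ b x ⟧)
    length-filterᵇ b []       = refl
    length-filterᵇ b (x ∷ xs) with b x
    ... | true  = cong suc (length-filterᵇ b xs)
    ... | false = length-filterᵇ b xs

    ∑-δ : (_≟ᴬ_ : DecidableEquality A) (xs : List A) → Unique xs → ∀ {y} → y ∈ xs → (g : A → ℕ) →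
      ∑ xs (λ x → ⟦ does (x ≟ᴬ y) ⟧ * g x) ≡ g y
    ∑-δ _≟ᴬ_ (x ∷ xs) (x∉xs ∷ _) (here refl) g with x ≟ᴬ x
    ... | no x≢x = ⊥-elim (x≢x refl)
    ... | yes _  = begin
      g x + 0 + ∑ xs (λ z → ⟦ does (z ≟ᴬ x) ⟧ * g z) ≡⟨ cong (g x + 0 +_) (∑-cong-∈ xs vanish) ⟩
      g x + 0 + ∑ xs (λ _ → 0)                     ≡⟨ cong (g x + 0 +_) (∑-zero xs) ⟩
      g x + 0 + 0                                  ≡⟨ cong (_+ 0) (+-identityʳ (g x)) ⟩
      g x + 0                                      ≡⟨ +-identityʳ (g x) ⟩
      g x                                          ∎
      where
      open ≡-Reasoning
      vanish : ∀ z → z ∈ xs → ⟦ does (z ≟ᴬ x) ⟧ * g z ≡ 0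
      vanish z z∈xs with z ≟ᴬ x
      ... | yes z≡x = ⊥-elim (All.lookup x∉xs z∈xs (sym z≡x))
      ... | no  _   = refl
    ∑-δ _≟ᴬ_ (x ∷ xs) (x∉xs ∷ u) {y} (there y∈xs) g with x ≟ᴬ y
    ... | no  _    = ∑-δ _≟ᴬ_ xs u y∈xs g
    ... | yes refl = ⊥-elim (All¬⇒¬Any x∉xs y∈xs)

  ∑-map : ∀ {A B : Set} (g : A → B) (xs : List A) (f : B → ℕ) → ∑ (map g xs) f ≡ ∑ xs (λ x → f (g x))
  ∑-map g []       f = refl
  ∑-map g (x ∷ xs) f = cong (f (g x) +_) (∑-map g xs f)

  ∑-concatMap : ∀ {A B : Set} (g : A → List B) (xs : List A) (f : B → ℕ) →
    ∑ (concatMap g xs) f ≡ ∑ xs (λ x → ∑ (g x) f)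
  ∑-concatMap g []       f = refl
  ∑-concatMap g (x ∷ xs) f = trans (∑-++ (g x) (concatMap g xs) f) (cong (∑ (g x) f +_) (∑-concatMap g xs f))

  ∑-comm : ∀ {A B : Set} (xs : List A) (ys : List B) (f : A → B → ℕ) →
    ∑ xs (λ x → ∑ ys (f x)) ≡ ∑ ys (λ y → ∑ xs (λ x → f x y))
  ∑-comm []       ys f = sym (∑-zero ys)
  ∑-comm (x ∷ xs) ys f =
    trans (cong (∑ ys (f x) +_) (∑-comm xs ys f)) (sym (∑-+ ys (f x) (λ y → ∑ xs (λ x′ → f x′ y))))

  signum-+ : ∀ a b → signum (a + b) ≤ signum a + signum b
  signum-+ zero    b = ≤-refl
  signum-+ (suc a) b = s≤s z≤n

  signum-* : ∀ a b → signum (a * b) ≤ a * signum b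
  signum-* zero    b       = z≤n
  signum-* (suc a) zero    rewrite *-zeroʳ a = z≤n
  signum-* (suc a) (suc b) = s≤s z≤n

  signum-∑ : ∀ {A : Set} (xs : List A) (f : A → ℕ) → signum (∑ xs f) ≤ ∑ xs (λ x → signum (f x))
  signum-∑ []       f = z≤n
  signum-∑ (x ∷ xs) f = ≤-trans (signum-+ (f x) _) (+-monoʳ-≤ (signum (f x)) (signum-∑ xs f))

  signum-% : ∀ a p .{{_ : NonZero p}} → signum (a % p) ≤ signum a
  signum-% zero    (suc p) = z≤n
  signum-% (suc a) p       with suc a % p
  ... | zero  = z≤n
  ... | suc _ = s≤s z≤n

  ⟦≢0⟧≡signum : ∀ a → ⟦ not (does (a ≟ 0)) ⟧ ≡ signum a
  ⟦≢0⟧≡signum zero    = refl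
  ⟦≢0⟧≡signum (suc a) = refl

  ∑-%-factor : ∀ {A : Set} p .{{_ : NonZero p}} (xs : List A) (f g : A → ℕ) →
    ∑ xs (λ x → f x % p * g x) % p ≡ ∑ xs (λ x → f x * g x) % p
  ∑-%-factor p []       f g = refl
  ∑-%-factor p (x ∷ xs) f g = begin
    (f x % p * g x + rest%) % p                   ≡⟨ %-distribˡ-+ (f x % p * g x) rest% p ⟩
    (f x % p * g x % p + rest% % p) % p           ≡⟨ cong₂ (λ a b → (a + b) % p) head-eq (∑-%-factor p xs f g) ⟩
    (f x * g x % p + rest % p) % p                ≡⟨ %-distribˡ-+ (f x * g x) rest p ⟨
    (f x * g x + rest) % p                        ∎
    where
    open ≡-Reasoning
    rest% = ∑ xs (λ y → f y % p * g y)
    rest  = ∑ xs (λ y → f y * g y)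
    head-eq : f x % p * g x % p ≡ f x * g x % p
    head-eq = begin
      f x % p * g x % p             ≡⟨ %-distribˡ-* (f x % p) (g x) p ⟩
      f x % p % p * (g x % p) % p   ≡⟨ cong (λ a → a * (g x % p) % p) (m%n%n≡m%n (f x) p) ⟩
      f x % p * (g x % p) % p       ≡⟨ %-distribˡ-* (f x) (g x) p ⟨
      f x * g x % p                 ∎

  mod-cong : ∀ {a b} p .{{_ : NonZero p}} → a % p ≡ b % p → a mod p ≡ b mod p
  mod-cong {a} {b} p eq = fromℕ<-cong (a % p) (b % p) eq (m%n<n a p) (m%n<n b p)

module Projective (F : FiniteField) where

  open import Algebra.Structures using (IsCommutativeRing)
  open import Data.Bool using (T)
  open import Data.Bool.Properties using (T-≡)
  open import Data.Empty using (⊥-elim)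
  open import Data.List using (map; concatMap)
  open import Data.List.Membership.Propositional using (_∈_)
  open import Data.List.Membership.Propositional.Properties using (∈-map⁺; ∈-concatMap⁺; ∈-filter⁻)
  open import Data.List.Relation.Unary.Any using (here)
  import Data.List.Relation.Unary.Any as Any
  open import Data.List.Relation.Unary.Any.Properties using (any⁺; any⁻)
  open import Data.Nat using (zero; suc) renaming (_*_ to _*ℕ_)
  import Data.Nat.Properties as ℕ
  open import Data.Nat.Tactic.RingSolver using (solve-∀)
  open import Data.Product using (∃; _×_; _,_; proj₁; proj₂)
  open import Data.Sum using (_⊎_; inj₁; inj₂)
  open import Data.Vec using (Vec; []; _∷_; zipWith; _++_)
  open import Data.Vec.Properties using (≡-dec)
  open import Function using (_∘_; Equivalence)
  open import Relation.Binary.PropositionalEquality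
  open import Relation.Nullary using (yes; no; does)
  open import Relation.Nullary.Decidable using (T?)

  open Counting
  open FiniteField F
  open IsCommutativeRing isCommutativeRing
    using (+-assoc; +-identityˡ; *-assoc; *-comm; *-identityˡ; *-identityʳ; distribˡ; distribʳ; zeroˡ; zeroʳ)

  infixl 6 _⊕_
  _⊕_ : ∀ {d} → Vec Carrier d → Vec Carrier d → Vec Carrier d
  _⊕_ = zipWith _+_

  ⊕-assoc : ∀ {d} (u v w : Vec Carrier d) → (u ⊕ v) ⊕ w ≡ u ⊕ (v ⊕ w)
  ⊕-assoc []      []      []      = refl
  ⊕-assoc (x ∷ u) (y ∷ v) (z ∷ w) = cong₂ _∷_ (+-assoc x y z) (⊕-assoc u v w)

  ⊕-identityˡ : ∀ {d} (v : Vec Carrier d) → zeroVec d ⊕ v ≡ v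
  ⊕-identityˡ []      = refl
  ⊕-identityˡ (x ∷ v) = cong₂ _∷_ (+-identityˡ x) (⊕-identityˡ v)

  scale-⊕ : ∀ {d} a (u v : Vec Carrier d) → scale a (u ⊕ v) ≡ scale a u ⊕ scale a v
  scale-⊕ a []      []      = refl
  scale-⊕ a (x ∷ u) (y ∷ v) = cong₂ _∷_ (distribˡ a x y) (scale-⊕ a u v)

  scale-+ : ∀ {d} a b (v : Vec Carrier d) → scale (a + b) v ≡ scale a v ⊕ scale b v
  scale-+ a b []      = refl
  scale-+ a b (x ∷ v) = cong₂ _∷_ (distribʳ x a b) (scale-+ a b v)

  scale-scale : ∀ {d} a b (v : Vec Carrier d) → scale a (scale b v) ≡ scale (a * b) v
  scale-scale a b []      = refl
  scale-scale a b (x ∷ v) = cong₂ _∷_ (sym (*-assoc a b x)) (scale-scale a b v)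

  scale-zeroˡ : ∀ {d} (v : Vec Carrier d) → scale 0# v ≡ zeroVec d
  scale-zeroˡ []      = refl
  scale-zeroˡ (x ∷ v) = cong₂ _∷_ (zeroˡ x) (scale-zeroˡ v)

  scale-zeroʳ : ∀ d a → scale a (zeroVec d) ≡ zeroVec d
  scale-zeroʳ zero    a = refl
  scale-zeroʳ (suc d) a = cong₂ _∷_ (zeroʳ a) (scale-zeroʳ d a)

  scale-identity : ∀ {d} (v : Vec Carrier d) → scale 1# v ≡ v
  scale-identity []      = refl
  scale-identity (x ∷ v) = cong₂ _∷_ (*-identityˡ x) (scale-identity v)

  scale-lincomb : ∀ {t d} a (b : Vec Carrier t) (g : Vec (Vec Carrier d) t) →
    scale a (lincomb b g) ≡ lincomb (scale a b) g
  scale-lincomb {d = d} a []      []      = scale-zeroʳ d a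
  scale-lincomb         a (x ∷ b) (h ∷ g) = begin
    scale a (scale x h ⊕ lincomb b g)           ≡⟨ scale-⊕ a _ _ ⟩
    scale a (scale x h) ⊕ scale a (lincomb b g) ≡⟨ cong₂ _⊕_ (scale-scale a x h) (scale-lincomb a b g) ⟩
    scale (a * x) h ⊕ lincomb (scale a b) g     ∎
    where open ≡-Reasoning

  lincomb-++ : ∀ {s t d} (a : Vec Carrier s) (b : Vec Carrier t) (g : Vec (Vec Carrier d) s) h →
    lincomb (a ++ b) (g ++ h) ≡ lincomb a g ⊕ lincomb b h
  lincomb-++ []      b []      h = sym (⊕-identityˡ _)
  lincomb-++ (x ∷ a) b (k ∷ g) h = trans (cong (scale x k ⊕_) (lincomb-++ a b g h)) (sym (⊕-assoc (scale x k) _ _))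

  vecEq⇒≡ : ∀ {d} (u v : Vec Carrier d) → T (vecEq u v) → u ≡ v
  vecEq⇒≡ u v t with ≡-dec _≟_ u v
  ... | yes u≡v = u≡v

  vecEq-refl : ∀ {d} (u : Vec Carrier d) → T (vecEq u u)
  vecEq-refl u with ≡-dec _≟_ u u
  ... | yes _   = _
  ... | no  u≢u = u≢u refl

  ∈-allVecs : ∀ d (v : Vec Carrier d) → v ∈ allVecs d
  ∈-allVecs zero    []      = here refl
  ∈-allVecs (suc d) (x ∷ v) =
    ∈-concatMap⁺ (λ z → map (z ∷_) (allVecs d))
      (Any.map (λ { refl → ∈-map⁺ (x ∷_) (∈-allVecs d v) }) (complete x))

  ⟦vecEq-∷⟧ : ∀ {d} x y (v w : Vec Carrier d) →
    ⟦ vecEq (x ∷ v) (y ∷ w) ⟧ ≡ ⟦ does (x ≟ y) ⟧ *ℕ ⟦ vecEq v w ⟧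
  ⟦vecEq-∷⟧ x y v w with x ≟ y | ≡-dec _≟_ v w
  ... | yes refl | yes refl = refl
  ... | yes refl | no  v≢w  = refl
  ... | no  x≢y  | _        = refl

  ∑-allVecs-δ : ∀ d (r : Vec Carrier d) (g : Vec Carrier d → ℕ) →
    ∑ (allVecs d) (λ v → ⟦ vecEq v r ⟧ *ℕ g v) ≡ g r
  ∑-allVecs-δ zero    []      g = trans (ℕ.+-identityʳ _) (ℕ.*-identityˡ _)
  ∑-allVecs-δ (suc d) (y ∷ r) g = begin
    ∑ (concatMap (λ x → map (x ∷_) (allVecs d)) elements) f
      ≡⟨ ∑-concatMap (λ x → map (x ∷_) (allVecs d)) elements f ⟩
    ∑ elements (λ x → ∑ (map (x ∷_) (allVecs d)) f)
      ≡⟨ ∑-cong elements (λ x → ∑-map (x ∷_) (allVecs d) f) ⟩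
    ∑ elements (λ x → ∑ (allVecs d) (λ v → f (x ∷ v)))
      ≡⟨ ∑-cong elements (λ x → trans (∑-cong (allVecs d) (split x)) (∑-*ˡ (allVecs d) ⟦ does (x ≟ y) ⟧ _)) ⟩
    ∑ elements (λ x → ⟦ does (x ≟ y) ⟧ *ℕ ∑ (allVecs d) (λ v → ⟦ vecEq v r ⟧ *ℕ g (x ∷ v)))
      ≡⟨ ∑-cong elements (λ x → cong (⟦ does (x ≟ y) ⟧ *ℕ_) (∑-allVecs-δ d r (λ v → g (x ∷ v)))) ⟩
    ∑ elements (λ x → ⟦ does (x ≟ y) ⟧ *ℕ g (x ∷ r))
      ≡⟨ ∑-δ _≟_ elements unique (complete y) (λ x → g (x ∷ r)) ⟩
    g (y ∷ r) ∎
    where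
    open ≡-Reasoning
    f : Vec Carrier (suc d) → ℕ
    f v = ⟦ vecEq v (y ∷ r) ⟧ *ℕ g v
    split : ∀ x v → f (x ∷ v) ≡ ⟦ does (x ≟ y) ⟧ *ℕ (⟦ vecEq v r ⟧ *ℕ g (x ∷ v))
    split x v = trans (cong (_*ℕ g (x ∷ v)) (⟦vecEq-∷⟧ x y v r))
                      (ℕ.*-assoc ⟦ does (x ≟ y) ⟧ ⟦ vecEq v r ⟧ (g (x ∷ v)))

  ∈-points⇒normalized : ∀ {d} {P : Vec Carrier d} → P ∈ points d → T (normalized P)
  ∈-points⇒normalized {d} P∈ = proj₂ (∈-filter⁻ (T? ∘ normalized) {xs = allVecs d} P∈)

  ∑-points-δ : ∀ d (r : Vec Carrier d) → T (normalized r) → (g : Vec Carrier d → ℕ) →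
    ∑ (points d) (λ P → ⟦ vecEq P r ⟧ *ℕ g P) ≡ g r
  ∑-points-δ d r r-norm g = begin
    ∑ (points d) (λ P → ⟦ vecEq P r ⟧ *ℕ g P)
      ≡⟨ ∑-filterᵇ normalized (allVecs d) _ ⟩
    ∑ (allVecs d) (λ P → ⟦ normalized P ⟧ *ℕ (⟦ vecEq P r ⟧ *ℕ g P))
      ≡⟨ ∑-cong (allVecs d) (λ P → swap ⟦ normalized P ⟧ ⟦ vecEq P r ⟧ (g P)) ⟩
    ∑ (allVecs d) (λ P → ⟦ vecEq P r ⟧ *ℕ (⟦ normalized P ⟧ *ℕ g P))
      ≡⟨ ∑-allVecs-δ d r (λ P → ⟦ normalized P ⟧ *ℕ g P) ⟩
    ⟦ normalized r ⟧ *ℕ g r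
      ≡⟨ cong (λ b → ⟦ b ⟧ *ℕ g r) (Equivalence.to T-≡ r-norm) ⟩
    1 *ℕ g r
      ≡⟨ ℕ.*-identityˡ (g r) ⟩
    g r ∎
    where
    open ≡-Reasoning
    swap : ∀ a b c → a *ℕ (b *ℕ c) ≡ b *ℕ (a *ℕ c)
    swap = solve-∀

  normalized-0∷ : ∀ {d} (v : Vec Carrier d) → normalized (0# ∷ v) ≡ normalized v
  normalized-0∷ v with 0# ≟ 1# | 0# ≟ 0#
  ... | yes 0≡1 | _       = ⊥-elim (0≢1 0≡1)
  ... | no  _   | yes _   = refl
  ... | no  _   | no  0≢0 = ⊥-elim (0≢0 refl)

  normalized-1∷ : ∀ {d} (v : Vec Carrier d) → T (normalized (1# ∷ v))
  normalized-1∷ v with 1# ≟ 1#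
  ... | yes _   = _
  ... | no  1≢1 = ⊥-elim (1≢1 refl)

  normalized-∷⁻ : ∀ {d} x (v : Vec Carrier d) → T (normalized (x ∷ v)) →
    x ≡ 1# ⊎ (x ≡ 0# × T (normalized v))
  normalized-∷⁻ x v t with x ≟ 1#
  ... | yes x≡1 = inj₁ x≡1
  ... | no  _   with x ≟ 0#
  ...   | yes x≡0 = inj₂ (x≡0 , t)

  normalized⇒≢0 : ∀ {d} (v : Vec Carrier d) → T (normalized v) → v ≢ zeroVec d
  normalized⇒≢0 (x ∷ v) t refl with normalized-∷⁻ 0# v t
  ... | inj₁ 0≡1       = 0≢1 0≡1
  ... | inj₂ (_ , t′)  = normalized⇒≢0 v t′ refl

  inv : ∀ x → x ≢ 0# → Carrier
  inv x x≢0 = proj₁ (inverse x x≢0)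

  inv-*ˡ : ∀ x (x≢0 : x ≢ 0#) → inv x x≢0 * x ≡ 1#
  inv-*ˡ x x≢0 = trans (*-comm _ x) (proj₂ (inverse x x≢0))

  scale-inv-scale : ∀ {d} a (a≢0 : a ≢ 0#) (v : Vec Carrier d) → scale (inv a a≢0) (scale a v) ≡ v
  scale-inv-scale a a≢0 v = begin
    scale (inv a a≢0) (scale a v) ≡⟨ scale-scale _ a v ⟩
    scale (inv a a≢0 * a) v       ≡⟨ cong (λ μ → scale μ v) (inv-*ˡ a a≢0) ⟩
    scale 1# v                    ≡⟨ scale-identity v ⟩
    v                             ∎
    where open ≡-Reasoning

  normalize : ∀ {d} → Vec Carrier d → Vec Carrier d
  normalize []      = []
  normalize (x ∷ v) with x ≟ 0#
  ... | yes _   = 0# ∷ normalize v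
  ... | no  x≢0 = 1# ∷ scale (inv x x≢0) v

  0∷≢0⇒≢0 : ∀ {d} {v : Vec Carrier d} → 0# ∷ v ≢ zeroVec (suc d) → v ≢ zeroVec d
  0∷≢0⇒≢0 ne refl = ne refl

  normalized-normalize : ∀ {d} (v : Vec Carrier d) → v ≢ zeroVec d → T (normalized (normalize v))
  normalized-normalize []      ne = ne refl
  normalized-normalize (x ∷ v) ne with x ≟ 0#
  ... | yes refl = subst T (sym (normalized-0∷ (normalize v))) (normalized-normalize v (0∷≢0⇒≢0 ne))
  ... | no  x≢0  = normalized-1∷ (scale (inv x x≢0) v)

  normalize-∝ : ∀ {d} (v : Vec Carrier d) → v ≢ zeroVec d → ∃ λ μ → normalize v ≡ scale μ v
  normalize-∝ []      ne = ⊥-elim (ne refl)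
  normalize-∝ (x ∷ v) ne with x ≟ 0#
  ... | yes refl = let μ , eq = normalize-∝ v (0∷≢0⇒≢0 ne) in μ , cong₂ _∷_ (sym (zeroʳ μ)) eq
  ... | no  x≢0  = inv x x≢0 , cong (_∷ scale (inv x x≢0) v) (sym (inv-*ˡ x x≢0))

  ∝-normalize : ∀ {d} (v : Vec Carrier d) → v ≢ zeroVec d → ∃ λ μ → v ≡ scale μ (normalize v)
  ∝-normalize []      ne = ⊥-elim (ne refl)
  ∝-normalize (x ∷ v) ne with x ≟ 0#
  ... | yes refl = let μ , eq = ∝-normalize v (0∷≢0⇒≢0 ne) in μ , cong₂ _∷_ (sym (zeroʳ μ)) eq
  ... | no  x≢0  = x , cong₂ _∷_ (sym (*-identityʳ x)) (sym scale-scale-inv)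
    where
    scale-scale-inv : scale x (scale (inv x x≢0) v) ≡ v
    scale-scale-inv = begin
      scale x (scale (inv x x≢0) v) ≡⟨ scale-scale x _ v ⟩
      scale (x * inv x x≢0) v       ≡⟨ cong (λ μ → scale μ v) (proj₂ (inverse x x≢0)) ⟩
      scale 1# v                    ≡⟨ scale-identity v ⟩
      v                             ∎
      where open ≡-Reasoning

  normalize-scale : ∀ {d} a (P : Vec Carrier d) → a ≢ 0# → T (normalized P) → normalize (scale a P) ≡ P
  normalize-scale a (x ∷ v) a≢0 t with normalized-∷⁻ x v t
  ... | inj₁ refl with (a * 1#) ≟ 0#
  ...   | yes a1≡0 = ⊥-elim (a≢0 (trans (sym (*-identityʳ a)) a1≡0))
  ...   | no  a1≢0 = cong (1# ∷_) (begin
    scale (inv (a * 1#) a1≢0) (scale a v)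
      ≡⟨ cong (λ b → scale (inv (a * 1#) a1≢0) (scale b v)) (*-identityʳ a) ⟨
    scale (inv (a * 1#) a1≢0) (scale (a * 1#) v)
      ≡⟨ scale-inv-scale (a * 1#) a1≢0 v ⟩
    v ∎)
    where open ≡-Reasoning
  normalize-scale a (x ∷ v) a≢0 t | inj₂ (refl , t′) with (a * 0#) ≟ 0#
  ...   | yes _    = cong (0# ∷_) (normalize-scale a v a≢0 t′)
  ...   | no  a0≢0 = ⊥-elim (a0≢0 (zeroʳ a))

  inSubspace⁺ : ∀ {d t} (κ : Subspace d t) (a : Vec Carrier t) →
    T (inSubspace κ (lincomb a (Subspace.gens κ)))
  inSubspace⁺ {t = t} κ a =
    any⁺ _ (Any.map (λ { refl → vecEq-refl (lincomb a (Subspace.gens κ)) }) (∈-allVecs t a))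

  inSubspace⁻ : ∀ {d t} (κ : Subspace d t) v → T (inSubspace κ v) →
    ∃ λ a → lincomb a (Subspace.gens κ) ≡ v
  inSubspace⁻ {t = t} κ v v∈κ =
    let a , t′ = Any.satisfied (any⁻ _ (allVecs t) v∈κ) in a , vecEq⇒≡ _ v t′

  inSubspace-scale : ∀ {d t} (κ : Subspace d t) μ v → T (inSubspace κ v) → T (inSubspace κ (scale μ v))
  inSubspace-scale κ μ v v∈κ with inSubspace⁻ κ v v∈κ
  ... | a , refl = subst (T ∘ inSubspace κ) (sym (scale-lincomb μ a _)) (inSubspace⁺ κ (scale μ a))

module Reduction (F K : FiniteField) (e : ℕ) (R : FieldReduction F K e) where

  open import Algebra.Structures using (IsCommutativeRing)
  open import Data.Bool using (Bool; true; false; T)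
  open import Data.Empty using (⊥-elim)
  open import Data.List using (filterᵇ)
  import Data.List.Relation.Unary.Any as Any
  open import Data.List.Relation.Unary.Any.Properties using (any⁺; any⁻)
  open import Data.Nat using (zero; suc) renaming (_*_ to _*ℕ_)
  open import Data.Nat.Tactic.RingSolver using (solve-∀)
  open import Data.Product using (_,_; proj₁; proj₂)
  open import Data.Vec using (Vec; []; _∷_; zipWith; _++_; take; drop; head; tail)
  import Data.Vec as Vec
  open import Data.Vec.Properties
    using (take-zipWith; drop-zipWith; take-map; drop-map; take++drop≡id; ++-injectiveˡ; ++-injectiveʳ)
  open import Function using (_∘_)
  open import Relation.Binary.PropositionalEquality
  open import Relation.Nullary using (yes; no)

  open Counting

  take-++ : ∀ {A : Set} {m n} (a : Vec A m) (b : Vec A n) → take m (a ++ b) ≡ a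
  take-++ {m = m} a b = ++-injectiveˡ (take m (a ++ b)) a (take++drop≡id m (a ++ b))

  drop-++ : ∀ {A : Set} {m n} (a : Vec A m) (b : Vec A n) → drop m (a ++ b) ≡ b
  drop-++ {m = m} a b = ++-injectiveʳ (take m (a ++ b)) a (take++drop≡id m (a ++ b))

  T-injective : ∀ {a b : Bool} → (T a → T b) → (T b → T a) → a ≡ b
  T-injective {false} {false} _   _   = refl
  T-injective {false} {true}  _   b⇒a = ⊥-elim (b⇒a _)
  T-injective {true}  {false} a⇒b _   = ⊥-elim (a⇒b _)
  T-injective {true}  {true}  _   _   = refl

  private
    module F  = FiniteField F
    module K  = FiniteField K
    module PF = Projective F
    module PK = Projective K
    module RF = IsCommutativeRing F.isCommutativeRing
    module RK = IsCommutativeRing K.isCommutativeRing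
  open FieldReduction R
  open K using () renaming (_+_ to infixl 6 _+ᴷ_; _*_ to infixl 7 _*ᴷ_; -_ to infix 8 -ᴷ_)
  open F using () renaming (_+_ to infixl 6 _+ᶠ_; _*_ to infixl 7 _*ᶠ_)
  open PK using (_⊕_)
  open PF using () renaming (_⊕_ to _⊕ᶠ_)

  ι-0 : ι F.0# ≡ K.0#
  ι-0 = begin
    a                        ≡⟨ RK.+-identityʳ a ⟨
    a +ᴷ K.0#                ≡⟨ cong (a +ᴷ_) (RK.-‿inverseʳ a) ⟨
    a +ᴷ (a +ᴷ -ᴷ a)         ≡⟨ RK.+-assoc a a (-ᴷ a) ⟨
    a +ᴷ a +ᴷ -ᴷ a           ≡⟨ cong (_+ᴷ -ᴷ a) (ι-+ F.0# F.0#) ⟨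
    ι (F.0# +ᶠ F.0#) +ᴷ -ᴷ a ≡⟨ cong (λ x → ι x +ᴷ -ᴷ a) (RF.+-identityˡ F.0#) ⟩
    a +ᴷ -ᴷ a                ≡⟨ RK.-‿inverseʳ a ⟩
    K.0#                     ∎
    where
    open ≡-Reasoning
    a = ι F.0#

  ιlincomb : ∀ {k} → Vec F.Carrier k → Vec K.Carrier k → K.Carrier
  ιlincomb a ws = Vec.foldr _ K._+_ K.0# (zipWith (λ x w → ι x *ᴷ w) a ws)

  ιlincomb-⊕ : ∀ {k} (a b : Vec F.Carrier k) ws → ιlincomb (a ⊕ᶠ b) ws ≡ ιlincomb a ws +ᴷ ιlincomb b ws
  ιlincomb-⊕ []      []      []       = sym (RK.+-identityˡ K.0#)
  ιlincomb-⊕ (x ∷ a) (y ∷ b) (w ∷ ws) = begin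
    ι (x +ᶠ y) *ᴷ w +ᴷ ιlincomb (a ⊕ᶠ b) ws
      ≡⟨ cong₂ (λ z s → z *ᴷ w +ᴷ s) (ι-+ x y) (ιlincomb-⊕ a b ws) ⟩
    (ι x +ᴷ ι y) *ᴷ w +ᴷ (ιlincomb a ws +ᴷ ιlincomb b ws)
      ≡⟨ cong (_+ᴷ (ιlincomb a ws +ᴷ ιlincomb b ws)) (RK.distribʳ w (ι x) (ι y)) ⟩
    (ι x *ᴷ w +ᴷ ι y *ᴷ w) +ᴷ (ιlincomb a ws +ᴷ ιlincomb b ws)
      ≡⟨ +-interchange ⟩
    (ι x *ᴷ w +ᴷ ιlincomb a ws) +ᴷ (ι y *ᴷ w +ᴷ ιlincomb b ws) ∎
    where
    open ≡-Reasoning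
    +-interchange : ∀ {p q r s} → (p +ᴷ q) +ᴷ (r +ᴷ s) ≡ (p +ᴷ r) +ᴷ (q +ᴷ s)
    +-interchange {p} {q} {r} {s} = begin
      (p +ᴷ q) +ᴷ (r +ᴷ s) ≡⟨ RK.+-assoc p q _ ⟩
      p +ᴷ (q +ᴷ (r +ᴷ s)) ≡⟨ cong (p +ᴷ_) (RK.+-assoc q r s) ⟨
      p +ᴷ ((q +ᴷ r) +ᴷ s) ≡⟨ cong (λ z → p +ᴷ (z +ᴷ s)) (RK.+-comm q r) ⟩
      p +ᴷ ((r +ᴷ q) +ᴷ s) ≡⟨ cong (p +ᴷ_) (RK.+-assoc r q s) ⟩
      p +ᴷ (r +ᴷ (q +ᴷ s)) ≡⟨ RK.+-assoc p r _ ⟨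
      (p +ᴷ r) +ᴷ (q +ᴷ s) ∎

  ιlincomb-scale : ∀ {k} x (a : Vec F.Carrier k) ws → ιlincomb (F.scale x a) ws ≡ ι x *ᴷ ιlincomb a ws
  ιlincomb-scale x []      []       = sym (RK.zeroʳ (ι x))
  ιlincomb-scale x (y ∷ a) (w ∷ ws) = begin
    ι (x *ᶠ y) *ᴷ w +ᴷ ιlincomb (F.scale x a) ws
      ≡⟨ cong₂ (λ z s → z *ᴷ w +ᴷ s) (ι-* x y) (ιlincomb-scale x a ws) ⟩
    (ι x *ᴷ ι y) *ᴷ w +ᴷ ι x *ᴷ ιlincomb a ws
      ≡⟨ cong (_+ᴷ (ι x *ᴷ ιlincomb a ws)) (RK.*-assoc (ι x) (ι y) w) ⟩
    ι x *ᴷ (ι y *ᴷ w) +ᴷ ι x *ᴷ ιlincomb a ws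
      ≡⟨ RK.distribˡ (ι x) (ι y *ᴷ w) (ιlincomb a ws) ⟨
    ι x *ᴷ (ι y *ᴷ w +ᴷ ιlincomb a ws) ∎
    where open ≡-Reasoning

  φ-⊕ : ∀ m (u v : Vec F.Carrier (m *ℕ e)) → φ m (u ⊕ᶠ v) ≡ φ m u ⊕ φ m v
  φ-⊕ zero    u v = refl
  φ-⊕ (suc m) u v rewrite take-zipWith {m = e} F._+_ u v | drop-zipWith {m = e} F._+_ u v =
    cong₂ _∷_ (ιlincomb-⊕ (take e u) (take e v) ω) (φ-⊕ m (drop e u) (drop e v))

  φ-scale : ∀ m x (u : Vec F.Carrier (m *ℕ e)) → φ m (F.scale x u) ≡ K.scale (ι x) (φ m u)
  φ-scale zero    x u = refl
  φ-scale (suc m) x u rewrite take-map (x F.*_) e u | drop-map (x F.*_) e u =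
    cong₂ _∷_ (ιlincomb-scale x (take e u) ω) (φ-scale m x (drop e u))

  φ-zero : ∀ m → φ m (F.zeroVec (m *ℕ e)) ≡ K.zeroVec m
  φ-zero m = begin
    φ m 0ᶠ                        ≡⟨ cong (φ m) (PF.scale-zeroʳ (m *ℕ e) F.0#) ⟨
    φ m (F.scale F.0# 0ᶠ)         ≡⟨ φ-scale m F.0# 0ᶠ ⟩
    K.scale (ι F.0#) (φ m 0ᶠ)     ≡⟨ cong (λ z → K.scale z (φ m 0ᶠ)) ι-0 ⟩
    K.scale K.0# (φ m 0ᶠ)         ≡⟨ PK.scale-zeroˡ (φ m 0ᶠ) ⟩
    K.zeroVec m                   ∎
    where
    open ≡-Reasoning
    0ᶠ = F.zeroVec (m *ℕ e)

  φ-injective : ∀ m (u v : Vec F.Carrier (m *ℕ e)) → φ m u ≡ φ m v → u ≡ v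
  φ-injective zero    [] [] _  = refl
  φ-injective (suc m) u  v  eq = begin
    u                    ≡⟨ take++drop≡id e u ⟨
    take e u ++ drop e u ≡⟨ cong₂ _++_ (coord-injective _ _ (cong head eq)) (φ-injective m _ _ (cong tail eq)) ⟩
    take e v ++ drop e v ≡⟨ take++drop≡id e v ⟩
    v                    ∎
    where open ≡-Reasoning

  φ⁻¹ : ∀ m → Vec K.Carrier m → Vec F.Carrier (m *ℕ e)
  φ⁻¹ zero    []      = []
  φ⁻¹ (suc m) (x ∷ v) = proj₁ (coord-surjective x) ++ φ⁻¹ m v

  φ-φ⁻¹ : ∀ m v → φ m (φ⁻¹ m v) ≡ v
  φ-φ⁻¹ zero    []      = refl
  φ-φ⁻¹ (suc m) (x ∷ v) rewrite take-++ (proj₁ (coord-surjective x)) (φ⁻¹ m v)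
                              | drop-++ (proj₁ (coord-surjective x)) (φ⁻¹ m v) =
    cong₂ _∷_ (proj₂ (coord-surjective x)) (φ-φ⁻¹ m v)

  multiples : ∀ {m k} → Vec K.Carrier m → Vec K.Carrier k → Vec (Vec F.Carrier (m *ℕ e)) k
  multiples {m} g ws = Vec.map (λ w → φ⁻¹ m (K.scale w g)) ws

  φ-lincomb-multiples : ∀ {m k} (g : Vec K.Carrier m) (a : Vec F.Carrier k) ws →
    φ m (F.lincomb a (multiples g ws)) ≡ K.scale (ιlincomb a ws) g
  φ-lincomb-multiples {m} g []      []       = trans (φ-zero m) (sym (PK.scale-zeroˡ g))
  φ-lincomb-multiples {m} g (x ∷ a) (w ∷ ws) = begin
    φ m (F.scale x (φ⁻¹ m (K.scale w g)) ⊕ᶠ F.lincomb a (multiples g ws))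
      ≡⟨ φ-⊕ m _ _ ⟩
    φ m (F.scale x (φ⁻¹ m (K.scale w g))) ⊕ φ m (F.lincomb a (multiples g ws))
      ≡⟨ cong₂ _⊕_ (trans (φ-scale m x _) (cong (K.scale (ι x)) (φ-φ⁻¹ m _))) (φ-lincomb-multiples g a ws) ⟩
    K.scale (ι x) (K.scale w g) ⊕ K.scale (ιlincomb a ws) g
      ≡⟨ cong (_⊕ K.scale (ιlincomb a ws) g) (PK.scale-scale (ι x) w g) ⟩
    K.scale (ι x *ᴷ w) g ⊕ K.scale (ιlincomb a ws) g
      ≡⟨ PK.scale-+ _ _ g ⟨
    K.scale (ιlincomb (x ∷ a) (w ∷ ws)) g ∎
    where open ≡-Reasoning

  -- the vectors φ⁻¹(ω_j g), g running over the K-basis of κ, form an F-basis of B(κ)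
  liftBasis : ∀ {m t} → Vec (Vec K.Carrier m) t → Vec (Vec F.Carrier (m *ℕ e)) (t *ℕ e)
  liftBasis []       = []
  liftBasis (g ∷ gs) = multiples g ω ++ liftBasis gs

  φ-lincomb-liftBasis : ∀ {m t} (a : Vec F.Carrier (t *ℕ e)) (gs : Vec (Vec K.Carrier m) t) →
    φ m (F.lincomb a (liftBasis gs)) ≡ K.lincomb (φ t a) gs
  φ-lincomb-liftBasis {m} {zero}  [] []       = φ-zero m
  φ-lincomb-liftBasis {m} {suc t} a  (g ∷ gs) = begin
    φ m (F.lincomb a (multiples g ω ++ liftBasis gs))
      ≡⟨ cong (λ z → φ m (F.lincomb z (multiples g ω ++ liftBasis gs))) (take++drop≡id e a) ⟨
    φ m (F.lincomb (take e a ++ drop e a) (multiples g ω ++ liftBasis gs))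
      ≡⟨ cong (φ m) (PF.lincomb-++ (take e a) (drop e a) (multiples g ω) (liftBasis gs)) ⟩
    φ m (F.lincomb (take e a) (multiples g ω) ⊕ᶠ F.lincomb (drop e a) (liftBasis gs))
      ≡⟨ φ-⊕ m _ _ ⟩
    φ m (F.lincomb (take e a) (multiples g ω)) ⊕ φ m (F.lincomb (drop e a) (liftBasis gs))
      ≡⟨ cong₂ _⊕_ (φ-lincomb-multiples g (take e a) ω) (φ-lincomb-liftBasis (drop e a) gs) ⟩
    K.lincomb (φ (suc t) a) (g ∷ gs) ∎
    where open ≡-Reasoning

  B : ∀ {m t} → K.Subspace m t → F.Subspace (m *ℕ e) (t *ℕ e)
  B {m} {t} κ = record { gens = liftBasis gs ; independent = independent }
    where
    gs = K.Subspace.gens κ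
    independent : ∀ a → F.lincomb a (liftBasis gs) ≡ F.zeroVec (m *ℕ e) → a ≡ F.zeroVec (t *ℕ e)
    independent a a-rel = φ-injective t a _ (begin
      φ t a               ≡⟨ K.Subspace.independent κ (φ t a) (begin
        K.lincomb (φ t a) gs               ≡⟨ φ-lincomb-liftBasis a gs ⟨
        φ m (F.lincomb a (liftBasis gs))   ≡⟨ cong (φ m) a-rel ⟩
        φ m (F.zeroVec (m *ℕ e))           ≡⟨ φ-zero m ⟩
        K.zeroVec m                        ∎) ⟩
      K.zeroVec t         ≡⟨ φ-zero t ⟨
      φ t (F.zeroVec (t *ℕ e)) ∎)
      where open ≡-Reasoning

  inSubspace-B : ∀ {m t} (κ : K.Subspace m t) Q → F.inSubspace (B κ) Q ≡ K.inSubspace κ (φ m Q)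
  inSubspace-B {m} {t} κ Q = T-injective to from
    where
    gs = K.Subspace.gens κ
    to : T (F.inSubspace (B κ) Q) → T (K.inSubspace κ (φ m Q))
    to Q∈Bκ with PF.inSubspace⁻ (B κ) Q Q∈Bκ
    ... | a , refl = subst (T ∘ K.inSubspace κ) (sym (φ-lincomb-liftBasis a gs)) (PK.inSubspace⁺ κ (φ t a))
    from : T (K.inSubspace κ (φ m Q)) → T (F.inSubspace (B κ) Q)
    from φQ∈κ with PK.inSubspace⁻ κ (φ m Q) φQ∈κ
    ... | b , b-eq = subst (T ∘ F.inSubspace (B κ)) lift-eq (PF.inSubspace⁺ (B κ) (φ⁻¹ t b))
      where
      lift-eq : F.lincomb (φ⁻¹ t b) (liftBasis gs) ≡ Q
      lift-eq = φ-injective m _ Q (begin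
        φ m (F.lincomb (φ⁻¹ t b) (liftBasis gs)) ≡⟨ φ-lincomb-liftBasis (φ⁻¹ t b) gs ⟩
        K.lincomb (φ t (φ⁻¹ t b)) gs             ≡⟨ cong (λ z → K.lincomb z gs) (φ-φ⁻¹ t b) ⟩
        K.lincomb b gs                           ≡⟨ b-eq ⟩
        φ m Q                                    ∎)
        where open ≡-Reasoning

  -- π(Q): the point P of PG(m-1, K) whose B(P) contains Q
  containingPoint : ∀ m → Vec F.Carrier (m *ℕ e) → Vec K.Carrier m
  containingPoint m Q = PK.normalize (φ m Q)

  φ-≢0 : ∀ m Q → T (F.normalized Q) → φ m Q ≢ K.zeroVec m
  φ-≢0 m Q Q-norm φQ≡0 = PF.normalized⇒≢0 Q Q-norm (φ-injective m Q _ (trans φQ≡0 (sym (φ-zero m))))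

  normalized-containingPoint : ∀ m Q → T (F.normalized Q) → T (K.normalized (containingPoint m Q))
  normalized-containingPoint m Q Q-norm = PK.normalized-normalize (φ m Q) (φ-≢0 m Q Q-norm)

  inB-containingPoint : ∀ m P Q → T (F.normalized Q) → T (K.normalized P) →
    inB m P Q ≡ K.vecEq P (containingPoint m Q)
  inB-containingPoint m P Q Q-norm P-norm = T-injective to from
    where
    to : T (inB m P Q) → T (K.vecEq P (containingPoint m Q))
    to Q∈BP with Any.satisfied (any⁻ _ K.elements Q∈BP)
    ... | λ′ , t with PK.vecEq⇒≡ (φ m Q) (K.scale λ′ P) t | λ′ K.≟ K.0#
    ...   | φQ≡λ′P | yes refl = ⊥-elim (φ-≢0 m Q Q-norm (trans φQ≡λ′P (PK.scale-zeroˡ P)))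
    ...   | φQ≡λ′P | no  λ′≢0 =
      subst (T ∘ K.vecEq P) (sym (trans (cong PK.normalize φQ≡λ′P) (PK.normalize-scale λ′ P λ′≢0 P-norm)))
            (PK.vecEq-refl P)
    from : T (K.vecEq P (containingPoint m Q)) → T (inB m P Q)
    from t with PK.vecEq⇒≡ P (containingPoint m Q) t | PK.∝-normalize (φ m Q) (φ-≢0 m Q Q-norm)
    ... | refl | μ , φQ≡μP =
      any⁺ _ (Any.map (λ { refl → subst (T ∘ K.vecEq (φ m Q)) φQ≡μP (PK.vecEq-refl (φ m Q)) }) (K.complete μ))

  inSubspace-containingPoint : ∀ {m t} (κ : K.Subspace m t) Q → T (F.normalized Q) →
    K.inSubspace κ (containingPoint m Q) ≡ F.inSubspace (B κ) Q
  inSubspace-containingPoint {m} κ Q Q-norm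
    with PK.normalize-∝ (φ m Q) (φ-≢0 m Q Q-norm) | PK.∝-normalize (φ m Q) (φ-≢0 m Q Q-norm)
  ... | μ , PQ≡μφQ | μ′ , φQ≡μ′PQ = trans (T-injective to from) (sym (inSubspace-B κ Q))
    where
    to : T (K.inSubspace κ (containingPoint m Q)) → T (K.inSubspace κ (φ m Q))
    to t = subst (T ∘ K.inSubspace κ) (sym φQ≡μ′PQ) (PK.inSubspace-scale κ μ′ _ t)
    from : T (K.inSubspace κ (φ m Q)) → T (K.inSubspace κ (containingPoint m Q))
    from t = subst (T ∘ K.inSubspace κ) (sym PQ≡μφQ) (PK.inSubspace-scale κ μ _ t)

  ∑-points-inB : ∀ m Q → T (F.normalized Q) → (g : Vec K.Carrier m → ℕ) →
    ∑ (K.points m) (λ P → ⟦ inB m P Q ⟧ *ℕ g P) ≡ g (containingPoint m Q)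
  ∑-points-inB m Q Q-norm g = begin
    ∑ (K.points m) (λ P → ⟦ inB m P Q ⟧ *ℕ g P)
      ≡⟨ ∑-cong-∈ (K.points m) (λ P P∈ →
           cong (λ b → ⟦ b ⟧ *ℕ g P) (inB-containingPoint m P Q Q-norm (PK.∈-points⇒normalized P∈))) ⟩
    ∑ (K.points m) (λ P → ⟦ K.vecEq P (containingPoint m Q) ⟧ *ℕ g P)
      ≡⟨ PK.∑-points-δ m (containingPoint m Q) (normalized-containingPoint m Q Q-norm) g ⟩
    g (containingPoint m Q) ∎
    where open ≡-Reasoning

  -- the sets B(P) partition the points of PG(me-1, F)
  ∑-fibres : ∀ m (f : Vec F.Carrier (m *ℕ e) → ℕ) (g : Vec K.Carrier m → ℕ) →
    ∑ (K.points m) (λ P → ∑ (filterᵇ (inB m P) (F.points (m *ℕ e))) f *ℕ g P)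
      ≡ ∑ (F.points (m *ℕ e)) (λ Q → f Q *ℕ g (containingPoint m Q))
  ∑-fibres m f g = begin
    ∑ Ps (λ P → ∑ (filterᵇ (inB m P) Qs) f *ℕ g P)
      ≡⟨ ∑-cong Ps (λ P → cong (_*ℕ g P) (∑-filterᵇ (inB m P) Qs f)) ⟩
    ∑ Ps (λ P → ∑ Qs (λ Q → ⟦ inB m P Q ⟧ *ℕ f Q) *ℕ g P)
      ≡⟨ ∑-cong Ps (λ P → ∑-*ʳ Qs (g P) _) ⟨
    ∑ Ps (λ P → ∑ Qs (λ Q → ⟦ inB m P Q ⟧ *ℕ f Q *ℕ g P))
      ≡⟨ ∑-comm Ps Qs _ ⟩
    ∑ Qs (λ Q → ∑ Ps (λ P → ⟦ inB m P Q ⟧ *ℕ f Q *ℕ g P))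
      ≡⟨ ∑-cong Qs (λ Q → trans (∑-cong Ps (λ P → reorder ⟦ inB m P Q ⟧ (f Q) (g P))) (∑-*ˡ Ps (f Q) _)) ⟩
    ∑ Qs (λ Q → f Q *ℕ ∑ Ps (λ P → ⟦ inB m P Q ⟧ *ℕ g P))
      ≡⟨ ∑-cong-∈ Qs (λ Q Q∈ → cong (f Q *ℕ_) (∑-points-inB m Q (PF.∈-points⇒normalized Q∈) g)) ⟩
    ∑ Qs (λ Q → f Q *ℕ g (containingPoint m Q)) ∎
    where
    open ≡-Reasoning
    Ps = K.points m
    Qs = F.points (m *ℕ e)
    reorder : ∀ b x y → b *ℕ x *ℕ y ≡ x *ℕ (b *ℕ y)
    reorder = solve-∀

module ReducedCode (p : ℕ) (pr : Prime p) (F K : FiniteField) (e : ℕ) (R : FieldReduction F K e) where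

  open import Data.Bool using (T; if_then_else_)
  open import Data.Bool.Properties using (T-≡)
  open import Data.Fin using (toℕ)
  open import Data.Fin.Properties using (toℕ-fromℕ<)
  open import Data.List using (map; filterᵇ)
  open import Data.Nat using (_*_; _≤_; _%_)
  open import Data.Nat.DivMod using (_mod_)
  open import Data.Nat.Properties using (*-identityʳ; module ≤-Reasoning)
  open import Data.Product using (_,_; proj₁; proj₂; map₂)
  open import Data.Vec using (Vec)
  open import Function using (_∘_; Equivalence)
  open import Relation.Binary.PropositionalEquality

  open Counting

  wt≡∑signum : ∀ (L : FiniteField) {d} (v : Codes.Fn L p pr d) →
    Codes.wt L p pr v ≡ ∑ (FiniteField.points L d) (λ P → signum (toℕ (v P)))
  wt≡∑signum L {d} v =
    trans (length-filterᵇ _ (FiniteField.points L d))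
          (∑-cong (FiniteField.points L d) (λ P → ⟦≢0⟧≡signum (toℕ (v P))))

  private
    module F  = FiniteField F
    module K  = FiniteField K
    module CF = Codes F p pr
    module CK = Codes K p pr
  open Codes F p pr using (p≢0)
  open FieldReduction R using (inB; reduce)
  open Reduction F K e R using (containingPoint; normalized-containingPoint; inSubspace-containingPoint; B; ∑-fibres)

  toℕ-reduce : ∀ m (c : CF.Fn (m * e)) P →
    toℕ (reduce p pr m c P) ≡ ∑ (filterᵇ (inB m P) (F.points (m * e))) (toℕ ∘ c) % p
  toℕ-reduce m c P = toℕ-fromℕ< _

  dot-reduce : ∀ m (c : CF.Fn (m * e)) (w : CK.Fn m) →
    CK.dot (reduce p pr m c) w ≡ CF.dot c (w ∘ containingPoint m)
  dot-reduce m c w = mod-cong p (begin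
    ∑ Ps (λ P → toℕ (reduce p pr m c P) * toℕ (w P)) % p
      ≡⟨ cong (_% p) (∑-cong Ps (λ P → cong (_* toℕ (w P)) (toℕ-reduce m c P))) ⟩
    ∑ Ps (λ P → fibre P % p * toℕ (w P)) % p
      ≡⟨ ∑-%-factor p Ps fibre (toℕ ∘ w) ⟩
    ∑ Ps (λ P → fibre P * toℕ (w P)) % p
      ≡⟨ cong (_% p) (∑-fibres m (toℕ ∘ c) (toℕ ∘ w)) ⟩
    ∑ (F.points (m * e)) (λ Q → toℕ (c Q) * toℕ (w (containingPoint m Q))) % p ∎)
    where
    open ≡-Reasoning
    Ps = K.points m
    fibre : Vec K.Carrier m → ℕ
    fibre P = ∑ (filterᵇ (inB m P) (F.points (m * e))) (toℕ ∘ c)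

  InCode-∘containingPoint : ∀ m t (w : CK.Fn m) → CK.InCode m t w →
    CF.InCode (m * e) (t * e) (w ∘ containingPoint m)
  InCode-∘containingPoint m t w (l , w≡) =
    map (map₂ B) l , λ Q Q-norm → pullback Q (Equivalence.from T-≡ Q-norm)
    where
    χ-B : ∀ κ Q → T (F.normalized Q) → CK.χ κ (containingPoint m Q) ≡ CF.χ (B κ) Q
    χ-B κ Q Q-norm = cong (λ b → (if b then 1 else 0) mod p) (inSubspace-containingPoint κ Q Q-norm)
    pullback : ∀ Q → T (F.normalized Q) → w (containingPoint m Q)
      ≡ CF.sumℕ (map (λ aκ → toℕ (proj₁ aκ) * toℕ (CF.χ (proj₂ aκ) Q)) (map (map₂ B) l)) mod p
    pullback Q Q-norm = begin
      w (containingPoint m Q)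
        ≡⟨ w≡ (containingPoint m Q) (Equivalence.to T-≡ (normalized-containingPoint m Q Q-norm)) ⟩
      CK.sumℕ (map (λ aκ → toℕ (proj₁ aκ) * toℕ (CK.χ (proj₂ aκ) (containingPoint m Q))) l) mod p
        ≡⟨ cong (_mod p) (∑-cong l (λ aκ → cong (λ x → toℕ (proj₁ aκ) * toℕ x) (χ-B (proj₂ aκ) Q Q-norm))) ⟩
      CF.sumℕ (map (λ aκ → toℕ (proj₁ aκ) * toℕ (CF.χ (B (proj₂ aκ)) Q)) l) mod p
        ≡⟨ cong (_mod p) (∑-map (map₂ B) l _) ⟨
      CF.sumℕ (map (λ aκ → toℕ (proj₁ aκ) * toℕ (CF.χ (proj₂ aκ) Q)) (map (map₂ B) l)) mod p ∎
      where open ≡-Reasoning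

  InDual-reduce : ∀ m t (c : CF.Fn (m * e)) → CF.InDual (m * e) (t * e) c → CK.InDual m t (reduce p pr m c)
  InDual-reduce m t c c⊥ w w∈ =
    trans (dot-reduce m c w) (c⊥ (w ∘ containingPoint m) (InCode-∘containingPoint m t w w∈))

  wt-reduce : ∀ m (c : CF.Fn (m * e)) → CK.wt (reduce p pr m c) ≤ CF.wt c
  wt-reduce m c = begin
    CK.wt (reduce p pr m c)
      ≡⟨ wt≡∑signum K (reduce p pr m c) ⟩
    ∑ Ps (λ P → signum (toℕ (reduce p pr m c P)))
      ≤⟨ ∑-mono Ps signum-reduce ⟩
    ∑ Ps (λ P → ∑ (filterᵇ (inB m P) Qs) s * 1)
      ≡⟨ ∑-fibres m s (λ _ → 1) ⟩
    ∑ Qs (λ Q → s Q * 1)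
      ≡⟨ ∑-cong Qs (λ Q → *-identityʳ (s Q)) ⟩
    ∑ Qs s
      ≡⟨ wt≡∑signum F c ⟨
    CF.wt c ∎
    where
    open ≤-Reasoning
    Ps = K.points m
    Qs = F.points (m * e)
    s : Vec F.Carrier (m * e) → ℕ
    s Q = signum (toℕ (c Q))
    signum-reduce : ∀ P → signum (toℕ (reduce p pr m c P)) ≤ ∑ (filterᵇ (inB m P) Qs) s * 1
    signum-reduce P = begin
      signum (toℕ (reduce p pr m c P))              ≡⟨ cong signum (toℕ-reduce m c P) ⟩
      signum (∑ (filterᵇ (inB m P) Qs) (toℕ ∘ c) % p) ≤⟨ signum-% _ p ⟩
      signum (∑ (filterᵇ (inB m P) Qs) (toℕ ∘ c))     ≤⟨ signum-∑ (filterᵇ (inB m P) Qs) (toℕ ∘ c) ⟩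
      ∑ (filterᵇ (inB m P) Qs) s                      ≡⟨ *-identityʳ _ ⟨
      ∑ (filterᵇ (inB m P) Qs) s * 1                  ∎

open import Data.Nat using (suc; _*_; _^_; _≤_)
open import Data.Product using (_×_; _,_)
open import Relation.Binary.PropositionalEquality using (_≡_)

mainTheorem19 : (p h : ℕ) (pr : Prime p) (n e : ℕ) → 2 ≤ n → 2 ≤ e →
    (F K : FiniteField) → FiniteField.order F ≡ p ^ h →
    (R : FieldReduction F K e) →
    (c : Codes.Fn F p pr (suc n * e)) →
    Codes.InDual F p pr (suc n * e) (2 * e) c →
    Codes.InDual K p pr (suc n) 2 (FieldReduction.reduce R p pr (suc n) c)
      × Codes.wt K p pr (FieldReduction.reduce R p pr (suc n) c) ≤ Codes.wt F p pr c
mainTheorem19 p h pr n e _ _ F K _ R c c⊥ = InDual-reduce (suc n) 2 c c⊥ , wt-reduce (suc n) c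
  where open ReducedCode p pr F K e R
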